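{- Let $n\ge k\ge1$. (1) Let $X$ be an $(n,k)$ right GOGAm trapezoid. Define $Z$ by $Z_{i,j}=X_{i,j}$ for $i-j\le k-1$, and $Z_{i,j}=1$ for $n\ge i\ge j+k$. Then $Z$ is a GOGAm triangle. Moreover, $Z$ is the smallest (entrywise) GOGAm triangle of size $n$ whose restriction to the positions $i-j\le k-1$ equals $X$. (2) Let $X$ be an $(n,k)$ left GOGAm trapezoid. Define $Z$ by $Z_{i,j}=X_{i,j}$ for $j\le k$, and $Z_{i,j}=X_{i-j+k,k}$ for $n\ge i\ge j\ge k$; thus the added entries are constant along SW-NE diagonals. Then $Z$ is a GOGAm triangle. Moreover, $Z$ is the smallest (entrywise) GOGAm triangle of size $n$ whose restriction to the positions $j\le k$ equals $X$.
   Context: A Gelfand-Tsetlin triangle of size $n$ is an array $X=(X_{i,j})_{n\ge i\ge j\ge 1}$ of positive integers with $X_{i+1,j}\le X_{i,j}\le X_{i+1,j+1}$ for $n-1\ge i\ge j\ge 1$. Triangles are ordered entrywise. A GOGAm triangle of size $n$ is a Gelfand-Tsetlin triangle such that $X_{n,n}\le n$ and the following holds for every $1\le k\le n-1$ and every sequence of integers $n=j_0>j_1>\dots>j_{n-k}\ge 1$: $$\sum_{i=0}^{n-k-1}\bigl(X_{j_i+i,\,j_i}-X_{j_{i+1}+i,\,j_{i+1}}\bigr)+X_{j_{n-k}+n-k,\,j_{n-k}}\le k.$$ An $(n,k)$ right GOGAm trapezoid is the array $(X_{i,j})_{n\ge i\ge j\ge 1,\ i-j\le k-1}$ obtained by restricting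 some GOGAm triangle of size $n$ to these positions. An $(n,k)$ left GOGAm trapezoid is the array $(X_{i,j})_{n\ge i\ge j\ge1,\ j\le k}$ obtained by restricting some GOGAm triangle of size $n$ to these positions. -}

module Defs where

open import Data.Nat using (ℕ; zero; suc; _+_; _∸_; _≤_; _<_; _<ᵇ_; _≤ᵇ_)
open import Data.Bool using (if_then_else_)
open import Data.Integer as ℤ using (ℤ; +_)
open import Data.Product using (Σ; _×_)
open import Relation.Binary.PropositionalEquality using (_≡_)

-- A triangular array is encoded as a function of (row i, column j);
-- only the entries at positions n ≥ i ≥ j ≥ 1 are meaningful.
Array : Set
Array = ℕ → ℕ → ℕ

InTri : ℕ → ℕ → ℕ → Set
InTri n i j = (1 ≤ j) × (j ≤ i) × (i ≤ n)

IsGT : ℕ → Array → Set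
IsGT n X =
  (∀ i j → InTri n i j → 1 ≤ X i j) ×
  (∀ i j → 1 ≤ j → j ≤ i → i < n →
     (X (suc i) j ≤ X i j) × (X i j ≤ X (suc i) (suc j)))

ΣZ : ℕ → (ℕ → ℤ) → ℤ
ΣZ zero    f = + 0
ΣZ (suc m) f = ΣZ m f ℤ.+ f m

-- the left-hand side of the GOGAm inequality for k and the sequence
-- j 0 > j 1 > ... > j (n - k)
gogamSum : ℕ → ℕ → (ℕ → ℕ) → Array → ℤ
gogamSum n k j X =
  ΣZ (n ∸ k) (λ i → (+ X (j i + i) (j i)) ℤ.- (+ X (j (suc i) + i) (j (suc i))))
  ℤ.+ (+ X (j (n ∸ k) + (n ∸ k)) (j (n ∸ k)))

IsGOGAm : ℕ → Array → Set
IsGOGAm n X =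
  IsGT n X ×
  (X n n ≤ n) ×
  (∀ k (j : ℕ → ℕ) → 1 ≤ k → k < n →
     j 0 ≡ n →
     (∀ i → i < n ∸ k → j (suc i) < j i) →
     1 ≤ j (n ∸ k) →
     gogamSum n k j X ℤ.≤ + k)

AgreeOn : ℕ → (ℕ → ℕ → Set) → Array → Array → Set
AgreeOn n P X Y = ∀ i j → InTri n i j → P i j → X i j ≡ Y i j

_≤[_]_ : Array → ℕ → Array → Set
X ≤[ n ] Y = ∀ i j → InTri n i j → X i j ≤ Y i j

RightPos : ℕ → ℕ → ℕ → Set
RightPos k i j = i ∸ j < k

LeftPos : ℕ → ℕ → ℕ → Set
LeftPos k i j = j ≤ k

IsRightTrap : ℕ → ℕ → Array → Set
IsRightTrap n k X = Σ Array (λ T → IsGOGAm n T × AgreeOn n (RightPos k) T X)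

IsLeftTrap : ℕ → ℕ → Array → Set
IsLeftTrap n k X = Σ Array (λ T → IsGOGAm n T × AgreeOn n (LeftPos k) T X)

extendRight : ℕ → Array → Array
extendRight k X i j = if (i ∸ j) <ᵇ k then X i j else 1

extendLeft : ℕ → Array → Array
extendLeft k X i j = if j ≤ᵇ k then X i j else X (i ∸ j + k) k

module Submission where

-- Fix a GOGAm triangle T of
-- size n that restricts to the given trapezoid X, and let Z be the proposed
-- extension of X.  We show
--   (a) Z is a Gelfand-Tsetlin triangle and Z ≤ T entrywise, and
--   (b) every "diagonal difference" Z(a+d,a) - Z(b+d,b) with b < a is at most
--       the corresponding difference of T.
-- Each summand of the GOGAm inequality is such a diagonal difference and the
-- final summand is a single entry, so (a) and (b) bound the GOGAm sum of Z by
-- that of T, hence by k; with Z(n,n) ≤ T(n,n) ≤ n this makes Z a GOGAm triangle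
-- (lemma dominated-isGOGAm).  Since (a) holds for every such T, Z is also the
-- smallest GOGAm triangle extending X.

open import Defs
open import Data.Nat using (ℕ; zero; suc; _+_; _∸_; _≤_; _<_; _<ᵇ_; _≤ᵇ_; z≤n; s≤s; s≤s⁻¹)
open import Data.Nat.Properties
  using ( ≤-refl; ≤-reflexive; ≤-trans; ≤-<-trans; <⇒≤; <⇒≱; ≮⇒≥; ≰⇒>
        ; n≤1+n; m<n⇒m<1+n; m≤n⇒m<n∨m≡n; m≤m+n; m≤n+m
        ; +-comm; +-monoʳ-≤; +-monoˡ-≤; +-monoʳ-<; ∸-monoˡ-≤; +-∸-assoc
        ; m+n∸m≡n; m∸n+n≡m; m+[n∸m]≡n; _<?_; _≤?_; <⇒<ᵇ; <ᵇ⇒<; ≤⇒≤ᵇ; ≤ᵇ⇒≤)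
open import Data.Integer as ℤ using (ℤ; +_; +≤+)
import Data.Integer.Properties as ℤP
open import Data.Product using (_×_; _,_; proj₁; proj₂)
open import Data.Sum using (inj₁; inj₂)
open import Data.Bool using (true; false)
open import Data.Empty using (⊥-elim)
open import Relation.Nullary using (yes; no)
open import Relation.Binary.PropositionalEquality using (_≡_; refl; sym; trans; cong; cong₂; subst; subst₂)

StrictlyDecreasing : ℕ → (ℕ → ℕ) → Set
StrictlyDecreasing L j = ∀ i → i < L → j (suc i) < j i

-- Each step lowers the value by at least one, so j i + i never exceeds j 0;
-- this keeps every summand of the GOGAm sum inside the triangle.
index+value≤head : ∀ {L j} → StrictlyDecreasing L j → ∀ i → i ≤ L → j i + i ≤ j 0
index+value≤head {j = j} dec zero _ = ≤-reflexive (+-comm (j 0) 0)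
index+value≤head {j = j} dec (suc i) i<L = begin
  j (suc i) + suc i   ≡⟨ +-comm (j (suc i)) (suc i) ⟩
  suc (i + j (suc i)) ≤⟨ +-monoʳ-< i (dec i i<L) ⟩
  i + j i             ≡⟨ +-comm i (j i) ⟩
  j i + i             ≤⟨ index+value≤head dec i (<⇒≤ i<L) ⟩
  j 0                 ∎
  where open Data.Nat.Properties.≤-Reasoning

-- The last term is the minimum, so 1 ≤ j L makes every column index positive.
last≤ : ∀ {j} L → StrictlyDecreasing L j → ∀ i → i ≤ L → j L ≤ j i
last≤ zero    dec .zero z≤n = ≤-refl
last≤ (suc L) dec i i≤L with m≤n⇒m<n∨m≡n i≤L
... | inj₂ refl = ≤-refl
... | inj₁ i<L  = ≤-trans (<⇒≤ (dec L ≤-refl))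
                          (last≤ L (λ t t<L → dec t (m<n⇒m<1+n t<L)) i (s≤s⁻¹ i<L))

pos-self : ∀ {n i j} → 1 ≤ j → j ≤ i → i < n → InTri n i j
pos-self 1≤j j≤i i<n = 1≤j , j≤i , <⇒≤ i<n

pos-down : ∀ {n i j} → 1 ≤ j → j ≤ i → i < n → InTri n (suc i) j
pos-down 1≤j j≤i i<n = 1≤j , ≤-trans j≤i (n≤1+n _) , i<n

pos-downRight : ∀ {n i j} → 1 ≤ j → j ≤ i → i < n → InTri n (suc i) (suc j)
pos-downRight 1≤j j≤i i<n = ≤-trans 1≤j (n≤1+n _) , s≤s j≤i , i<n

pos-diagonal : ∀ {n a b} d → 1 ≤ b → b < a → a + d ≤ n →
               InTri n (a + d) a × InTri n (b + d) b
pos-diagonal d 1≤b b<a a+d≤n =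
  (≤-trans 1≤b (<⇒≤ b<a) , m≤m+n _ d , a+d≤n) ,
  (1≤b , m≤m+n _ d , ≤-trans (+-monoˡ-≤ d (<⇒≤ b<a)) a+d≤n)

-- The entries of a Gelfand-Tsetlin triangle weakly increase along each
-- diagonal i - j = d (chain the inequalities T(i,j) ≤ T(i+1,j+1)).
diagonal-mono : ∀ {n} {T : Array} → IsGT n T → ∀ d {a b} → 1 ≤ b → b ≤ a → a + d ≤ n →
                T (b + d) b ≤ T (a + d) a
diagonal-mono gt d {zero} 1≤b b≤a _ = ⊥-elim (<⇒≱ (≤-trans 1≤b b≤a) z≤n)
diagonal-mono {T = T} gt@(_ , interlace) d {suc a} {b} 1≤b b≤1+a 1+a+d≤n
  with m≤n⇒m<n∨m≡n b≤1+a
... | inj₂ refl = ≤-refl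
... | inj₁ b<1+a = ≤-trans (diagonal-mono gt d 1≤b b≤a (≤-trans (n≤1+n _) 1+a+d≤n)) step
  where
  b≤a : b ≤ a
  b≤a = s≤s⁻¹ b<1+a
  step : T (a + d) a ≤ T (suc (a + d)) (suc a)
  step = proj₂ (interlace (a + d) a (≤-trans 1≤b b≤a) (m≤m+n a d) 1+a+d≤n)

diff-monoˡ : ∀ {a c} b → a ≤ c → + a ℤ.- + b ℤ.≤ + c ℤ.- + b
diff-monoˡ b a≤c = ℤP.+-monoˡ-≤ (ℤ.- + b) (+≤+ a≤c)

self-diff≤ : ∀ a {c d} → d ≤ c → + a ℤ.- + a ℤ.≤ + c ℤ.- + d
self-diff≤ a d≤c =
  subst (ℤ._≤ _) (sym (ℤP.+-inverseʳ (+ a))) (ℤP.i≤j⇒0≤j-i (+≤+ d≤c))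

-- The GOGAm sums only involve differences of two entries on one diagonal.
diagDiff : Array → ℕ → ℕ → ℕ → ℤ
diagDiff X d a b = + X (a + d) a ℤ.- + X (b + d) b

DiagDominated : ℕ → Array → Array → Set
DiagDominated n Z T =
  ∀ d a b → 1 ≤ b → b < a → a + d ≤ n → diagDiff Z d a b ℤ.≤ diagDiff T d a b

ΣZ-mono : ∀ m {f g : ℕ → ℤ} → (∀ i → i < m → f i ℤ.≤ g i) → ΣZ m f ℤ.≤ ΣZ m g
ΣZ-mono zero    _  = ℤP.≤-refl
ΣZ-mono (suc m) le = ℤP.+-mono-≤ (ΣZ-mono m (λ i i<m → le i (m<n⇒m<1+n i<m))) (le m ≤-refl)

dominated-isGOGAm : ∀ {n} {Z T : Array} → 1 ≤ n → IsGOGAm n T →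
                    IsGT n Z → Z ≤[ n ] T → DiagDominated n Z T → IsGOGAm n Z
dominated-isGOGAm {n} {Z} {T} 1≤n (_ , Tnn≤n , T-gogam) Z-gt Z≤T Z⊑T =
  Z-gt ,
  ≤-trans (Z≤T n n (1≤n , ≤-refl , ≤-refl)) Tnn≤n ,
  λ k j 1≤k k<n j0≡n dec 1≤last →
    ℤP.≤-trans (sum≤ k j j0≡n dec 1≤last) (T-gogam k j 1≤k k<n j0≡n dec 1≤last)
  where
  sum≤ : ∀ k j → j 0 ≡ n → StrictlyDecreasing (n ∸ k) j → 1 ≤ j (n ∸ k) →
         gogamSum n k j Z ℤ.≤ gogamSum n k j T
  sum≤ k j j0≡n dec 1≤last = ℤP.+-mono-≤ (ΣZ-mono L summand≤) (+≤+ (Z≤T _ _ lastPos))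
    where
    L : ℕ
    L = n ∸ k
    inside : ∀ i → i ≤ L → j i + i ≤ n
    inside i i≤L = subst (j i + i ≤_) j0≡n (index+value≤head dec i i≤L)
    summand≤ : ∀ i → i < L → diagDiff Z i (j i) (j (suc i)) ℤ.≤ diagDiff T i (j i) (j (suc i))
    summand≤ i i<L = Z⊑T i (j i) (j (suc i)) (≤-trans 1≤last (last≤ L dec (suc i) i<L))
                         (dec i i<L) (inside i (<⇒≤ i<L))
    lastPos : InTri n (j L + L) (j L)
    lastPos = 1≤last , m≤m+n _ L , inside L ≤-refl

interlacing-inherited : ∀ {n i j} {Z T : Array} → IsGT n T → 1 ≤ j → j ≤ i → i < n →
  Z (suc i) j ≤ T (suc i) j → Z i j ≡ T i j → Z (suc i) (suc j) ≡ T (suc i) (suc j) →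
  (Z (suc i) j ≤ Z i j) × (Z i j ≤ Z (suc i) (suc j))
interlacing-inherited (_ , interlace) 1≤j j≤i i<n below Z≡T Z≡T↘ =
  ≤-trans below (≤-trans down (≤-reflexive (sym Z≡T))) ,
  ≤-trans (≤-reflexive Z≡T) (≤-trans up (≤-reflexive (sym Z≡T↘)))
  where
  down = proj₁ (interlace _ _ 1≤j j≤i i<n)
  up   = proj₂ (interlace _ _ 1≤j j≤i i<n)

module RightExtension (k : ℕ) (X : Array) where

  Z : Array
  Z = extendRight k X

  Z-inside : ∀ {i j} → i ∸ j < k → Z i j ≡ X i j
  Z-inside {i} {j} i∸j<k with (i ∸ j) <ᵇ k | <⇒<ᵇ i∸j<k
  ... | true  | _  = refl
  ... | false | ()

  Z-outside : ∀ {i j} → k ≤ i ∸ j → Z i j ≡ 1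
  Z-outside {i} {j} k≤i∸j with (i ∸ j) <ᵇ k | <ᵇ⇒< (i ∸ j) k
  ... | true  | lt = ⊥-elim (<⇒≱ (lt _) k≤i∸j)
  ... | false | _  = refl

  module _ {n : ℕ} {T : Array} (T-gt : IsGT n T) (T≡X : AgreeOn n (RightPos k) T X) where

    Z≡T : ∀ {i j} → InTri n i j → i ∸ j < k → Z i j ≡ T i j
    Z≡T p i∸j<k = trans (Z-inside i∸j<k) (sym (T≡X _ _ p i∸j<k))

    -- Z is below T: it copies T near the main diagonal and is 1 elsewhere.
    minimal : Z ≤[ n ] T
    minimal i j p with i ∸ j <? k
    ... | yes i∸j<k = ≤-reflexive (Z≡T p i∸j<k)
    ... | no  i∸j≮k = subst (_≤ T i j) (sym (Z-outside (≮⇒≥ i∸j≮k))) (proj₁ T-gt i j p)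

    isGT : IsGT n Z
    isGT = positive , interlacing
      where
      positive : ∀ i j → InTri n i j → 1 ≤ Z i j
      positive i j p with i ∸ j <? k
      ... | yes i∸j<k = subst (1 ≤_) (sym (Z≡T p i∸j<k)) (proj₁ T-gt i j p)
      ... | no  i∸j≮k = ≤-reflexive (sym (Z-outside (≮⇒≥ i∸j≮k)))

      -- Outside the band, (i,j), (i+1,j) and (i+1,j+1) all carry the entry 1.
      interlacing : ∀ i j → 1 ≤ j → j ≤ i → i < n →
                    (Z (suc i) j ≤ Z i j) × (Z i j ≤ Z (suc i) (suc j))
      interlacing i j 1≤j j≤i i<n with i ∸ j <? k
      ... | yes i∸j<k =
        interlacing-inherited {Z = Z} T-gt 1≤j j≤i i<n (minimal _ _ (pos-down 1≤j j≤i i<n))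
          (Z≡T (pos-self 1≤j j≤i i<n) i∸j<k) (Z≡T (pos-downRight 1≤j j≤i i<n) i∸j<k)
      ... | no i∸j≮k =
        ≤-reflexive (trans (Z-outside {suc i} {j} (≤-trans k≤i∸j (∸-monoˡ-≤ j (n≤1+n i))))
                           (sym (Z-outside {i} {j} k≤i∸j))) ,
        ≤-reflexive (trans (Z-outside {i} {j} k≤i∸j) (sym (Z-outside {suc i} {suc j} k≤i∸j)))
        where
        k≤i∸j : k ≤ i ∸ j
        k≤i∸j = ≮⇒≥ i∸j≮k

    -- A diagonal either lies in the band, where Z = T, or outside it, where
    -- Z is constantly 1 while T increases along the diagonal.
    dominated : DiagDominated n Z T
    dominated d a b 1≤b b<a a+d≤n with d <? k | pos-diagonal d 1≤b b<a a+d≤n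
    ... | yes d<k | pa , pb =
      ℤP.≤-reflexive (cong₂ (λ x y → + x ℤ.- + y) (Z≡T pa (onDiagonal a)) (Z≡T pb (onDiagonal b)))
      where
      onDiagonal : ∀ c → c + d ∸ c < k
      onDiagonal c = subst (_< k) (sym (m+n∸m≡n c d)) d<k
    ... | no d≮k | _ =
      ℤP.≤-trans (ℤP.≤-reflexive (cong₂ (λ x y → + x ℤ.- + y) (offDiagonal a) (offDiagonal b)))
                 (self-diff≤ 1 (diagonal-mono T-gt d 1≤b (<⇒≤ b<a) a+d≤n))
      where
      offDiagonal : ∀ c → Z (c + d) c ≡ 1
      offDiagonal c = Z-outside (subst (k ≤_) (sym (m+n∸m≡n c d)) (≮⇒≥ d≮k))

rightExtension : ∀ {n} k → 1 ≤ n → (X : Array) → IsRightTrap n k X →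
  IsGOGAm n (extendRight k X) ×
  AgreeOn n (RightPos k) (extendRight k X) X ×
  ((T : Array) → IsGOGAm n T → AgreeOn n (RightPos k) T X → extendRight k X ≤[ n ] T)
rightExtension k 1≤n X (T , T-gogam@(T-gt , _) , T≡X) =
  dominated-isGOGAm 1≤n T-gogam (isGT T-gt T≡X) (minimal T-gt T≡X) (dominated T-gt T≡X) ,
  (λ _ _ _ → Z-inside) ,
  (λ T′ (T′-gt , _) T′≡X → minimal T′-gt T′≡X)
  where open RightExtension k X

module LeftExtension (k : ℕ) (X : Array) where

  Z : Array
  Z = extendLeft k X

  Z-inside : ∀ {i j} → j ≤ k → Z i j ≡ X i j
  Z-inside {i} {j} j≤k with j ≤ᵇ k | ≤⇒≤ᵇ j≤k
  ... | true  | _  = refl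
  ... | false | ()

  Z-outside : ∀ {i j} → k < j → Z i j ≡ X (i ∸ j + k) k
  Z-outside {i} {j} k<j with j ≤ᵇ k | ≤ᵇ⇒≤ j k
  ... | true  | le = ⊥-elim (<⇒≱ k<j (le _))
  ... | false | _  = refl

  foot≤row : ∀ {i j} → k ≤ j → j ≤ i → i ∸ j + k ≤ i
  foot≤row {i} {j} k≤j j≤i = ≤-trans (+-monoʳ-≤ (i ∸ j) k≤j) (≤-reflexive (m∸n+n≡m j≤i))

  module _ {n : ℕ} {T : Array} (1≤k : 1 ≤ k)
           (T-gt : IsGT n T) (T≡X : AgreeOn n (LeftPos k) T X) where

    footPos : ∀ {i j} → InTri n i j → k ≤ j → InTri n (i ∸ j + k) k
    footPos {i} {j} (_ , j≤i , i≤n) k≤j =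
      1≤k , m≤n+m k (i ∸ j) , ≤-trans (foot≤row k≤j j≤i) i≤n

    Z≡T : ∀ {i j} → InTri n i j → j ≤ k → Z i j ≡ T i j
    Z≡T p j≤k = trans (Z-inside j≤k) (sym (T≡X _ _ p j≤k))

    Z≡T-foot : ∀ {i j} → InTri n i j → k ≤ j → Z i j ≡ T (i ∸ j + k) k
    Z≡T-foot p@(_ , j≤i , _) k≤j with m≤n⇒m<n∨m≡n k≤j
    ... | inj₁ k<j  = trans (Z-outside k<j) (sym (T≡X _ _ (footPos p k≤j) ≤-refl))
    ... | inj₂ refl = trans (Z≡T p ≤-refl) (cong (λ r → T r k) (sym (m∸n+n≡m j≤i)))

    -- Z is below T, since T increases along each diagonal beyond column k.
    minimal : Z ≤[ n ] T
    minimal i j p@(_ , j≤i , i≤n) with j ≤? k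
    ... | yes j≤k = ≤-reflexive (Z≡T p j≤k)
    ... | no  j≰k = ≤-trans (≤-reflexive (Z≡T-foot p k≤j)) climb
      where
      k≤j : k ≤ j
      k≤j = <⇒≤ (≰⇒> j≰k)
      climb : T (i ∸ j + k) k ≤ T i j
      climb = subst₂ _≤_ (cong (λ r → T r k) (+-comm k (i ∸ j)))
                         (cong (λ r → T r j) (m+[n∸m]≡n j≤i))
                         (diagonal-mono T-gt (i ∸ j) 1≤k k≤j
                            (subst (_≤ n) (sym (m+[n∸m]≡n j≤i)) i≤n))

    isGT : IsGT n Z
    isGT = positive , interlacing
      where
      positive : ∀ i j → InTri n i j → 1 ≤ Z i j
      positive i j p with j ≤? k
      ... | yes j≤k = subst (1 ≤_) (sym (Z≡T p j≤k)) (proj₁ T-gt i j p)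
      ... | no  j≰k = subst (1 ≤_) (sym (Z≡T-foot p k≤j)) (proj₁ T-gt _ _ (footPos p k≤j))
        where
        k≤j : k ≤ j
        k≤j = <⇒≤ (≰⇒> j≰k)

      -- Beyond column k the interlacing of Z at (i,j) is the interlacing of T
      -- at the foot (i-j+k, k) of the diagonal; before it, that of T at (i,j).
      interlacing : ∀ i j → 1 ≤ j → j ≤ i → i < n →
                    (Z (suc i) j ≤ Z i j) × (Z i j ≤ Z (suc i) (suc j))
      interlacing i j 1≤j j≤i i<n with k ≤? j
      ... | yes k≤j = down , ≤-reflexive (trans (Z≡T-foot self k≤j) (sym (Z≡T-foot downRight k≤1+j)))
        where
        self : InTri n i j
        self = pos-self 1≤j j≤i i<n
        downRight : InTri n (suc i) (suc j)
        downRight = pos-downRight 1≤j j≤i i<n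
        k≤1+j : k ≤ suc j
        k≤1+j = ≤-trans k≤j (n≤1+n j)
        foot<n : i ∸ j + k < n
        foot<n = ≤-<-trans (foot≤row k≤j j≤i) i<n
        down : Z (suc i) j ≤ Z i j
        down = begin
          Z (suc i) j             ≡⟨ Z≡T-foot (pos-down 1≤j j≤i i<n) k≤j ⟩
          T (suc i ∸ j + k) k     ≡⟨ cong (λ r → T (r + k) k) (+-∸-assoc 1 j≤i) ⟩
          T (suc (i ∸ j + k)) k   ≤⟨ proj₁ (proj₂ T-gt _ _ 1≤k (m≤n+m k (i ∸ j)) foot<n) ⟩
          T (i ∸ j + k) k         ≡⟨ sym (Z≡T-foot self k≤j) ⟩
          Z i j                   ∎
          where open Data.Nat.Properties.≤-Reasoning
      ... | no k≰j =
        interlacing-inherited {Z = Z} T-gt 1≤j j≤i i<n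
          (≤-reflexive (Z≡T (pos-down 1≤j j≤i i<n) (<⇒≤ j<k)))
          (Z≡T (pos-self 1≤j j≤i i<n) (<⇒≤ j<k)) (Z≡T (pos-downRight 1≤j j≤i i<n) j<k)
        where
        j<k : j < k
        j<k = ≰⇒> k≰j

    -- If both columns are at least k the two entries of Z coincide, while T
    -- increases along the diagonal; otherwise the smaller column lies in the
    -- trapezoid and the larger entry of Z is below that of T.
    dominated : DiagDominated n Z T
    dominated d a b 1≤b b<a a+d≤n with k ≤? b | pos-diagonal d 1≤b b<a a+d≤n
    ... | yes k≤b | pa , pb =
      ℤP.≤-trans (ℤP.≤-reflexive (cong₂ (λ x y → + x ℤ.- + y)
                                        (Z-onDiagonal pa (≤-trans k≤b (<⇒≤ b<a)))
                                        (Z-onDiagonal pb k≤b)))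
                 (self-diff≤ (T (d + k) k) (diagonal-mono T-gt d 1≤b (<⇒≤ b<a) a+d≤n))
      where
      Z-onDiagonal : ∀ {c} → InTri n (c + d) c → k ≤ c → Z (c + d) c ≡ T (d + k) k
      Z-onDiagonal {c} p k≤c = trans (Z≡T-foot p k≤c) (cong (λ r → T (r + k) k) (m+n∸m≡n c d))
    ... | no k≰b | pa , pb =
      ℤP.≤-trans (ℤP.≤-reflexive (cong (λ y → + Z (a + d) a ℤ.- + y) (Z≡T pb b≤k)))
                 (diff-monoˡ (T (b + d) b) (minimal _ _ pa))
      where
      b≤k : b ≤ k
      b≤k = <⇒≤ (≰⇒> k≰b)

leftExtension : ∀ {n} k → 1 ≤ k → 1 ≤ n → (X : Array) → IsLeftTrap n k X →
  IsGOGAm n (extendLeft k X) ×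
  AgreeOn n (LeftPos k) (extendLeft k X) X ×
  ((T : Array) → IsGOGAm n T → AgreeOn n (LeftPos k) T X → extendLeft k X ≤[ n ] T)
leftExtension k 1≤k 1≤n X (T , T-gogam@(T-gt , _) , T≡X) =
  dominated-isGOGAm 1≤n T-gogam (isGT 1≤k T-gt T≡X) (minimal 1≤k T-gt T≡X)
                    (dominated 1≤k T-gt T≡X) ,
  (λ _ _ _ → Z-inside) ,
  (λ T′ (T′-gt , _) T′≡X → minimal 1≤k T′-gt T′≡X)
  where open LeftExtension k X

mainTheorem2 : (n k : ℕ) → 1 ≤ k → k ≤ n →
    ((X : Array) → IsRightTrap n k X →
      IsGOGAm n (extendRight k X) ×
      AgreeOn n (RightPos k) (extendRight k X) X ×
      ((T : Array) → IsGOGAm n T → AgreeOn n (RightPos k) T X →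
        extendRight k X ≤[ n ] T))
    ×
    ((X : Array) → IsLeftTrap n k X →
      IsGOGAm n (extendLeft k X) ×
      AgreeOn n (LeftPos k) (extendLeft k X) X ×
      ((T : Array) → IsGOGAm n T → AgreeOn n (LeftPos k) T X →
        extendLeft k X ≤[ n ] T))
mainTheorem2 n k 1≤k k≤n = rightExtension k 1≤n , leftExtension k 1≤k 1≤n
  where
  1≤n : 1 ≤ n
  1≤n = ≤-trans 1≤k k≤n
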